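{- Let $C$ be a self-dual $L$-code of length $n$. Then there is a polynomial $F(X_1,X_2,X_3)$, weighted homogeneous of weighted degree $n$ with respect to weights $1,1,2$, such that $$\mathrm{EW}_C(a,b)=F\bigl(a^2+ab,\ a^2+b^2,\ a^4+a^2b^2+2b^4\bigr).$$
   Context: Let $L=\{0,1,\omega,\bar\omega\}$ be the Klein four-group $\mathbf{Z}_2\times\mathbf{Z}_2$. Define $|0|^2=0$, $|1|^2=1$, $|\omega|^2=|\bar\omega|^2=2$; the dot product $x\cdot y\in\mathbf{F}_2$ is $1$ iff $x,y$ are distinct and nonzero. On $L^n$: $(\mathbf{x},\mathbf{y})=\sum_i x_i\cdot y_i$, $\mathrm{ewt}(\mathbf{x})=\sum_i|x_i|^2$. An $L$-code is a subgroup $C\subseteq L^n$; it is self-dual if $C=\{\mathbf{z}:(\mathbf{z},\mathbf{y})=0\ \forall\mathbf{y}\in C\}$. The Euclidean weight enumerator is $\mathrm{EW}_C(a,b)=\sum_{\mathbf{c}\in C}a^{2n-\mathrm{ewt}(\mathbf{c})}b^{\mathrm{ewt}(\mathbf{c})}$. -}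

module Defs where

open import Data.Bool using (Bool; true; false; _xor_)
open import Data.Nat using (ℕ; zero; suc; _∸_) renaming (_+_ to _+ℕ_; _*_ to _*ℕ_)
open import Data.Vec using (Vec; []; _∷_; zipWith; replicate)
open import Data.List using (List; []; _∷_; foldr; map)
open import Data.Product using (_×_; _,_)
open import Data.Rational using (ℚ; 0ℚ; 1ℚ; _+_; _*_)
open import Data.Integer using (+_)
open import Data.Rational using (_/_)

data L : Set where
  𝟘 𝟙 ω ω̄ : L

_⊕_ : L → L → L
𝟘 ⊕ y = y
x ⊕ 𝟘 = x
𝟙 ⊕ 𝟙 = 𝟘
𝟙 ⊕ ω = ω̄
𝟙 ⊕ ω̄ = ω
ω ⊕ 𝟙 = ω̄
ω ⊕ ω = 𝟘
ω ⊕ ω̄ = 𝟙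
ω̄ ⊕ 𝟙 = ω
ω̄ ⊕ ω = 𝟙
ω̄ ⊕ ω̄ = 𝟘

nrm : L → ℕ
nrm 𝟘 = 0
nrm 𝟙 = 1
nrm ω = 2
nrm ω̄ = 2

dot : L → L → Bool
dot 𝟘 _ = false
dot _ 𝟘 = false
dot 𝟙 𝟙 = false
dot ω ω = false
dot ω̄ ω̄ = false
dot _ _ = true

inner : ∀ {n} → Vec L n → Vec L n → Bool
inner [] [] = false
inner (x ∷ xs) (y ∷ ys) = dot x y xor inner xs ys

ewt : ∀ {n} → Vec L n → ℕ
ewt [] = 0
ewt (x ∷ xs) = nrm x +ℕ ewt xs

zeroV : ∀ n → Vec L n
zeroV n = replicate n 𝟘

addV : ∀ {n} → Vec L n → Vec L n → Vec L n
addV = zipWith _⊕_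

pow : ℚ → ℕ → ℚ
pow x zero = 1ℚ
pow x (suc k) = x * pow x k

sumℚ : List ℚ → ℚ
sumℚ = foldr _+_ 0ℚ

-- Euclidean weight enumerator of a code given as a duplicate-free list of codewords,
-- evaluated at (a, b)
EW : ∀ {n} → List (Vec L n) → ℚ → ℚ → ℚ
EW {n} C a b = sumℚ (map (λ c → pow a ((2 *ℕ n) ∸ ewt c) * pow b (ewt c)) C)

-- A polynomial in X1, X2, X3 with rational coefficients, as a list of monomials
-- (coefficient, i, j, k) standing for coeff * X1^i X2^j X3^k
Poly3 : Set
Poly3 = List (ℚ × ℕ × ℕ × ℕ)

evalMon : ℚ → ℚ → ℚ → (ℚ × ℕ × ℕ × ℕ) → ℚ
evalMon x₁ x₂ x₃ (c , i , j , k) = c * pow x₁ i * pow x₂ j * pow x₃ k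

eval3 : Poly3 → ℚ → ℚ → ℚ → ℚ
eval3 F x₁ x₂ x₃ = sumℚ (map (evalMon x₁ x₂ x₃) F)

wdeg : (ℚ × ℕ × ℕ × ℕ) → ℕ
wdeg (c , i , j , k) = i +ℕ j +ℕ 2 *ℕ k

two : ℚ
two = 1ℚ + 1ℚ

module Submission where

-- For letter weights (x, y, z) on (0, 1, {ω, ω̄}) put
-- W_C(x, y, z) = ∑_{c ∈ C} ∏ᵢ weight(cᵢ), so that EW_C(a, b) = W_C(a², ab, b²).
-- 1. Fourier analysis on Lⁿ.  The transform of a product weight is the product of the
--    transforms, and for a self-dual C the character sums ∑_{y ∈ C} (-1)^(v,y) equal
--    |C|·[v ∈ C].  This yields the MacWilliams identity |C| W_C(p) = 2ⁿ W_C(T p) for the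
--    involution T(x, y, z) = ½ (x + y + 2z, x + y − 2z, x − y); using it at p and at T p
--    gives W_C(T p) = W_C(p) without computing |C|.
-- 2. Even/odd splitting.  With u = a² + ab, v = a² + b², X = a⁴ + a²b² + 2b⁴ and
--    m = a² − ab − 2b² one has m² = M(u, v, X) for M = 4X₃ − 3X₁² − 4X₂² + 4X₁X₂.  Each
--    letter weight at p = (a², ab, b²) is α u + β v + γ m, and at T p it is α u + β v − γ m.
--    Multiplying out letter by letter and replacing m² by M writes the weight of a word c
--    as E_c(u, v, X) + m O_c(u, v, X), with E_c weighted homogeneous of degree n.
-- 3. Averaging W_C(p) and W_C(T p) = W_C(p) cancels the odd parts, so F = ∑_{c ∈ C} E_c.

open import Defs
open import Data.Nat using (ℕ)
open import Data.Bool using (false)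
open import Data.Vec using (Vec)
open import Data.List using (List)
open import Data.List.Membership.Propositional using (_∈_)
open import Data.List.Relation.Unary.Unique.Propositional using (Unique)
open import Data.List.Relation.Unary.All using (All)
open import Data.Product using (Σ; _×_)
open import Data.Rational using (ℚ; _+_; _*_)
open import Relation.Binary.PropositionalEquality using (_≡_)
open import Function.Bundles using (_⇔_)

open import Level using (0ℓ)
open import Algebra.Bundles using (CommutativeRing; CommutativeMonoid)
open import Data.Bool using (Bool; true; _xor_)
import Data.Bool.Properties as Bool
open import Data.Empty using (⊥-elim)
open import Data.Nat using (zero; suc)
import Data.Nat as ℕ
import Data.Nat.Properties as ℕ
open import Data.Nat.Tactic.RingSolver using () renaming (solve-∀ to ℕ-solve-∀)
open import Data.Product using (_,_; ∃; proj₁; proj₂)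
open import Data.Rational using (-_; _-_; 0ℚ; 1ℚ; ½; 1/_; NonZero; Positive; NonNegative)
open import Data.Rational.Properties
  using ( +-*-commutativeRing; _≟_; +-identityˡ; +-assoc; *-comm; *-assoc; *-identityˡ; *-identityʳ
        ; *-zeroˡ; *-zeroʳ; *-distribˡ-+; neg-distrib-+; neg-distribˡ-*; *-inverseˡ; pos⇒nonZero
        ; nonNeg+nonNeg⇒nonNeg; nonNeg+pos⇒pos; pos*pos⇒pos )
open import Data.Vec using ([]; _∷_)
open import Data.Vec.Properties using (∷-injective; ≡-dec)
open import Data.List using ([]; _∷_; map; _++_; filter; concatMap; cartesianProductWith)
open import Data.List.Membership.Propositional using (find)
open import Data.List.Membership.Propositional.Properties
  using (∈-map⁺; ∈-map⁻; ∈-filter⁺; ∈-filter⁻; ∈-cartesianProductWith⁺)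
open import Data.List.Membership.Propositional.Properties.WithK using (unique∧set⇒bag)
open import Data.List.Relation.Binary.BagAndSetEquality using (∼bag⇒↭)
open import Data.List.Relation.Binary.Permutation.Propositional using (_↭_)
import Data.List.Relation.Binary.Permutation.Propositional as ↭
open import Data.List.Relation.Unary.All using ([]; _∷_; all?)
import Data.List.Relation.Unary.All as All
import Data.List.Relation.Unary.All.Properties as All
open import Data.List.Relation.Unary.AllPairs using ([]; _∷_)
open import Data.List.Relation.Unary.Any using (here; there)
open import Data.List.Relation.Unary.Unique.Propositional.Properties using (map⁺; filter⁺; cartesianProductWith⁺)
open import Function.Bundles using (mk⇔; Equivalence)
open import Relation.Binary.Definitions using (DecidableEquality)
open import Relation.Binary.PropositionalEquality using (refl; sym; trans; subst; cong; cong₂; module ≡-Reasoning)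
open import Relation.Nullary using (¬_; Dec; yes; no)
open import Relation.Nullary.Decidable using (map′; _×-dec_; toWitness; dec⇒maybe)
open import Relation.Unary using (Decidable)
open import Tactic.RingSolver using (solve-∀)
open import Tactic.RingSolver.Core.AlmostCommutativeRing using (AlmostCommutativeRing; fromCommutativeRing)
open import Algebra.Properties.CommutativeSemigroup
  (CommutativeMonoid.commutativeSemigroup (CommutativeRing.+-commutativeMonoid Bool.xor-∧-commutativeRing))
  using () renaming (interchange to xor-interchange)

ℚ-ring : AlmostCommutativeRing 0ℓ 0ℓ
ℚ-ring = fromCommutativeRing +-*-commutativeRing (λ x → dec⇒maybe (0ℚ ≟ x))

∑ : {A : Set} → (A → ℚ) → List A → ℚ
∑ f xs = sumℚ (map f xs)

private
  variable
    A B : Set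

∑-cong : {f g : A → ℚ} (xs : List A) → (∀ x → x ∈ xs → f x ≡ g x) → ∑ f xs ≡ ∑ g xs
∑-cong [] _ = refl
∑-cong (x ∷ xs) f≡g = cong₂ _+_ (f≡g x (here refl)) (∑-cong xs (λ y y∈xs → f≡g y (there y∈xs)))

∑-cong′ : {f g : A → ℚ} (xs : List A) → (∀ x → f x ≡ g x) → ∑ f xs ≡ ∑ g xs
∑-cong′ xs f≡g = ∑-cong xs (λ x _ → f≡g x)

∑-++ : (f : A → ℚ) (xs ys : List A) → ∑ f (xs ++ ys) ≡ ∑ f xs + ∑ f ys
∑-++ f [] ys = sym (+-identityˡ (∑ f ys))
∑-++ f (x ∷ xs) ys = trans (cong (f x +_) (∑-++ f xs ys)) (sym (+-assoc (f x) (∑ f xs) (∑ f ys)))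

∑-+ : (f g : A → ℚ) (xs : List A) → ∑ (λ x → f x + g x) xs ≡ ∑ f xs + ∑ g xs
∑-+ f g [] = refl
∑-+ f g (x ∷ xs) = trans (cong (f x + g x +_) (∑-+ f g xs)) (interchange (f x) (g x) (∑ f xs) (∑ g xs))
  where
  interchange : ∀ a b c d → (a + b) + (c + d) ≡ (a + c) + (b + d)
  interchange = solve-∀ ℚ-ring

∑-*ˡ : (k : ℚ) (f : A → ℚ) (xs : List A) → ∑ (λ x → k * f x) xs ≡ k * ∑ f xs
∑-*ˡ k f [] = sym (*-zeroʳ k)
∑-*ˡ k f (x ∷ xs) = trans (cong (k * f x +_) (∑-*ˡ k f xs)) (sym (*-distribˡ-+ k (f x) (∑ f xs)))

∑-*ʳ : (f : A → ℚ) (k : ℚ) (xs : List A) → ∑ (λ x → f x * k) xs ≡ ∑ f xs * k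
∑-*ʳ f k xs = trans (∑-cong′ xs (λ x → *-comm (f x) k)) (trans (∑-*ˡ k f xs) (*-comm k (∑ f xs)))

∑-neg : (f : A → ℚ) (xs : List A) → ∑ (λ x → - f x) xs ≡ - ∑ f xs
∑-neg f [] = refl
∑-neg f (x ∷ xs) = trans (cong (- f x +_) (∑-neg f xs)) (sym (neg-distrib-+ (f x) (∑ f xs)))

∑-map : (f : B → ℚ) (g : A → B) (xs : List A) → ∑ f (map g xs) ≡ ∑ (λ x → f (g x)) xs
∑-map f g [] = refl
∑-map f g (x ∷ xs) = cong (f (g x) +_) (∑-map f g xs)

∑-zero : (xs : List A) → ∑ (λ _ → 0ℚ) xs ≡ 0ℚ
∑-zero [] = refl
∑-zero (x ∷ xs) = trans (cong (0ℚ +_) (∑-zero xs)) (+-identityˡ 0ℚ)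

∑-swap : (F : A → B → ℚ) (xs : List A) (ys : List B) →
  ∑ (λ x → ∑ (F x) ys) xs ≡ ∑ (λ y → ∑ (λ x → F x y) xs) ys
∑-swap F [] ys = sym (∑-zero ys)
∑-swap F (x ∷ xs) ys =
  trans (cong (∑ (F x) ys +_) (∑-swap F xs ys)) (sym (∑-+ (F x) (λ y → ∑ (λ x → F x y) xs) ys))

∑-↭ : (f : A → ℚ) {xs ys : List A} → xs ↭ ys → ∑ f xs ≡ ∑ f ys
∑-↭ f ↭.refl = refl
∑-↭ f (↭.prep x p) = cong (f x +_) (∑-↭ f p)
∑-↭ f (↭.swap x y p) = trans (cong (λ s → f x + (f y + s)) (∑-↭ f p)) (swap-heads (f x) (f y) _)
  where
  swap-heads : ∀ a b s → a + (b + s) ≡ b + (a + s)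
  swap-heads = solve-∀ ℚ-ring
∑-↭ f (↭.trans p q) = trans (∑-↭ f p) (∑-↭ f q)

∑-sameElements : (f : A → ℚ) {xs ys : List A} → Unique xs → Unique ys →
  (∀ {z} → z ∈ xs ⇔ z ∈ ys) → ∑ f xs ≡ ∑ f ys
∑-sameElements f uxs uys same = ∑-↭ f (∼bag⇒↭ (unique∧set⇒bag uxs uys same))

∑-cartesianProductWith : {C : Set} (f : C → ℚ) (g : A → B → C) (xs : List A) (ys : List B) →
  ∑ f (cartesianProductWith g xs ys) ≡ ∑ (λ x → ∑ (λ y → f (g x y)) ys) xs
∑-cartesianProductWith f g [] ys = refl
∑-cartesianProductWith f g (x ∷ xs) ys = begin
  ∑ f (map (g x) ys ++ cartesianProductWith g xs ys)
    ≡⟨ ∑-++ f (map (g x) ys) _ ⟩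
  ∑ f (map (g x) ys) + ∑ f (cartesianProductWith g xs ys)
    ≡⟨ cong₂ _+_ (∑-map f (g x) ys) (∑-cartesianProductWith f g xs ys) ⟩
  ∑ (λ y → f (g x y)) ys + ∑ (λ x → ∑ (λ y → f (g x y)) ys) xs ∎
  where open ≡-Reasoning

∑-concatMap : (f : B → ℚ) (g : A → List B) (xs : List A) → ∑ f (concatMap g xs) ≡ ∑ (λ x → ∑ f (g x)) xs
∑-concatMap f g [] = refl
∑-concatMap f g (x ∷ xs) = trans (∑-++ f (g x) (concatMap g xs)) (cong (∑ f (g x) +_) (∑-concatMap f g xs))

indicator : {P : Set} → Dec P → ℚ
indicator (yes _) = 1ℚ
indicator (no _) = 0ℚ

∑-filter : {P : A → Set} (P? : Decidable P) (f : A → ℚ) (xs : List A) →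
  ∑ (λ x → indicator (P? x) * f x) xs ≡ ∑ f (filter P? xs)
∑-filter P? f [] = refl
∑-filter P? f (x ∷ xs) with P? x
... | yes _ = cong₂ _+_ (*-identityˡ (f x)) (∑-filter P? f xs)
... | no _ = trans (cong₂ _+_ (*-zeroˡ (f x)) (∑-filter P? f xs)) (+-identityˡ _)

self-negative⇒zero : ∀ x → x ≡ - x → x ≡ 0ℚ
self-negative⇒zero x x≡-x = begin
  x               ≡⟨ halve x ⟩
  ½ * (x + x)     ≡⟨ cong (λ t → ½ * (x + t)) x≡-x ⟩
  ½ * (x + - x)   ≡⟨ cancel x ⟩
  0ℚ ∎
  where
  open ≡-Reasoning
  halve : ∀ x → x ≡ ½ * (x + x)
  halve = solve-∀ ℚ-ring
  cancel : ∀ x → ½ * (x + - x) ≡ 0ℚ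
  cancel = solve-∀ ℚ-ring

positive-cancel : ∀ p → Positive p → ∀ d → p * d ≡ 0ℚ → d ≡ 0ℚ
positive-cancel p p>0 d pd≡0 = begin
  d                    ≡⟨ sym (*-identityˡ d) ⟩
  1ℚ * d               ≡⟨ cong (_* d) (sym (*-inverseˡ p {{p≢0}})) ⟩
  (1/ p) {{p≢0}} * p * d   ≡⟨ *-assoc ((1/ p) {{p≢0}}) p d ⟩
  (1/ p) {{p≢0}} * (p * d) ≡⟨ cong ((1/ p) {{p≢0}} *_) pd≡0 ⟩
  (1/ p) {{p≢0}} * 0ℚ      ≡⟨ *-zeroʳ ((1/ p) {{p≢0}}) ⟩
  0ℚ ∎
  where
  open ≡-Reasoning
  p≢0 : NonZero p
  p≢0 = pos⇒nonZero p {{p>0}}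

∑-ones-nonNegative : (xs : List A) → NonNegative (∑ (λ _ → 1ℚ) xs)
∑-ones-nonNegative [] = _
∑-ones-nonNegative (x ∷ xs) = nonNeg+nonNeg⇒nonNeg 1ℚ (∑ (λ _ → 1ℚ) xs) {{∑-ones-nonNegative xs}}

-- If s a = t b and s b = t a with s + t > 0, then a = b, since (s + t)(a − b) = 0.
swapped-equations⇒equal : ∀ s t a b → Positive (s + t) → s * a ≡ t * b → s * b ≡ t * a → a ≡ b
swapped-equations⇒equal s t a b s+t>0 sa≡tb sb≡ta = begin
  a             ≡⟨ shift a b ⟩
  (a - b) + b   ≡⟨ cong (_+ b) (positive-cancel (s + t) s+t>0 (a - b) vanishes) ⟩
  0ℚ + b        ≡⟨ +-identityˡ b ⟩
  b ∎
  where
  open ≡-Reasoning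
  shift : ∀ u w → u ≡ (u - w) + w
  shift = solve-∀ ℚ-ring
  expand : ∀ s t a b → (s + t) * (a - b) ≡ (s * a - t * b) + (t * a - s * b)
  expand = solve-∀ ℚ-ring
  cancel : ∀ u w → (u - u) + (w - w) ≡ 0ℚ
  cancel = solve-∀ ℚ-ring
  vanishes : (s + t) * (a - b) ≡ 0ℚ
  vanishes = begin
    (s + t) * (a - b)                 ≡⟨ expand s t a b ⟩
    (s * a - t * b) + (t * a - s * b) ≡⟨ cong₂ (λ u w → (u - t * b) + (t * a - w)) sa≡tb sb≡ta ⟩
    (t * b - t * b) + (t * a - t * a) ≡⟨ cancel (t * b) (t * a) ⟩
    0ℚ ∎

pow-positive : ∀ {x} → Positive x → ∀ n → Positive (pow x n)
pow-positive x>0 zero = _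
pow-positive {x} x>0 (suc n) = pos*pos⇒pos x {{x>0}} (pow x n) {{pow-positive x>0 n}}

pow-+ : ∀ x i j → pow x (i ℕ.+ j) ≡ pow x i * pow x j
pow-+ x zero j = sym (*-identityˡ (pow x j))
pow-+ x (suc i) j = trans (cong (x *_) (pow-+ x i j)) (sym (*-assoc x (pow x i) (pow x j)))

elementsL : List L
elementsL = 𝟘 ∷ 𝟙 ∷ ω ∷ ω̄ ∷ []

elementsL-complete : (x : L) → x ∈ elementsL
elementsL-complete 𝟘 = here refl
elementsL-complete 𝟙 = there (here refl)
elementsL-complete ω = there (there (here refl))
elementsL-complete ω̄ = there (there (there (here refl)))

elementsL-unique : Unique elementsL
elementsL-unique = ((λ ()) ∷ (λ ()) ∷ (λ ()) ∷ []) ∷ ((λ ()) ∷ (λ ()) ∷ []) ∷ ((λ ()) ∷ []) ∷ [] ∷ []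

_≟L_ : DecidableEquality L
x ≟L y = map′ code-injective (cong code) (code x ℕ.≟ code y)
  where
  code : L → ℕ
  code 𝟘 = 0
  code 𝟙 = 1
  code ω = 2
  code ω̄ = 3
  decode : ℕ → L
  decode 0 = 𝟘
  decode 1 = 𝟙
  decode 2 = ω
  decode _ = ω̄
  decode-code : ∀ x → decode (code x) ≡ x
  decode-code 𝟘 = refl
  decode-code 𝟙 = refl
  decode-code ω = refl
  decode-code ω̄ = refl
  code-injective : ∀ {x y} → code x ≡ code y → x ≡ y
  code-injective {x} {y} e = trans (sym (decode-code x)) (trans (cong decode e) (decode-code y))

-- A decidable property holds on all of L iff it holds on the four elements; this
-- turns identities between the finitely many values of L into checked computations.
∀L? : {P : L → Set} → (∀ x → Dec (P x)) → Dec (∀ x → P x)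
∀L? P? = map′ (λ (p₀ , p₁ , p₂ , p₃) → λ { 𝟘 → p₀ ; 𝟙 → p₁ ; ω → p₂ ; ω̄ → p₃ })
              (λ p → p 𝟘 , p 𝟙 , p ω , p ω̄)
              (P? 𝟘 ×-dec P? 𝟙 ×-dec P? ω ×-dec P? ω̄)

⊕-self-inverse : ∀ a x → a ⊕ (a ⊕ x) ≡ x
⊕-self-inverse = toWitness {a? = ∀L? λ a → ∀L? λ x → (a ⊕ (a ⊕ x)) ≟L x} _

dot-linear : ∀ x a b → dot x (a ⊕ b) ≡ (dot x a xor dot x b)
dot-linear = toWitness {a? = ∀L? λ x → ∀L? λ a → ∀L? λ b → dot x (a ⊕ b) Bool.≟ (dot x a xor dot x b)} _

χ : Bool → ℚ
χ false = 1ℚ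
χ true = - 1ℚ

χ-xor : ∀ a b → χ (a xor b) ≡ χ a * χ b
χ-xor false false = refl
χ-xor false true = refl
χ-xor true false = refl
χ-xor true true = refl

words : (n : ℕ) → List (Vec L n)
words zero = [] ∷ []
words (suc n) = cartesianProductWith _∷_ elementsL (words n)

words-complete : ∀ {n} (v : Vec L n) → v ∈ words n
words-complete [] = here refl
words-complete (x ∷ v) = ∈-cartesianProductWith⁺ _∷_ (elementsL-complete x) (words-complete v)

words-unique : (n : ℕ) → Unique (words n)
words-unique zero = [] ∷ []
words-unique (suc n) = cartesianProductWith⁺ _∷_ ∷-injective elementsL-unique (words-unique n)

addV-self-inverse : ∀ {n} (a w : Vec L n) → addV a (addV a w) ≡ w
addV-self-inverse [] [] = refl
addV-self-inverse (a ∷ as) (x ∷ w) = cong₂ _∷_ (⊕-self-inverse a x) (addV-self-inverse as w)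

inner-linear : ∀ {n} (v a b : Vec L n) → inner v (addV a b) ≡ (inner v a xor inner v b)
inner-linear [] [] [] = refl
inner-linear (x ∷ v) (a ∷ as) (b ∷ bs) = begin
  dot x (a ⊕ b) xor inner v (addV as bs)
    ≡⟨ cong₂ _xor_ (dot-linear x a b) (inner-linear v as bs) ⟩
  (dot x a xor dot x b) xor (inner v as xor inner v bs)
    ≡⟨ xor-interchange (dot x a) (dot x b) (inner v as) (inner v bs) ⟩
  (dot x a xor inner v as) xor (dot x b xor inner v bs) ∎
  where open ≡-Reasoning

weight : ∀ {n} → (L → ℚ) → Vec L n → ℚ
weight g [] = 1ℚ
weight g (x ∷ v) = g x * weight g v

fourier : (L → ℚ) → L → ℚ
fourier g y = ∑ (λ x → χ (dot x y) * g x) elementsL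

fourier-weight : (g : L → ℚ) {n : ℕ} (y : Vec L n) →
  ∑ (λ v → χ (inner v y) * weight g v) (words n) ≡ weight (fourier g) y
fourier-weight g [] = refl
fourier-weight g {suc n} (y ∷ ys) = begin
  ∑ (λ v → χ (inner v (y ∷ ys)) * weight g v) (words (suc n))
    ≡⟨ ∑-cartesianProductWith _ _∷_ elementsL (words n) ⟩
  ∑ (λ x → ∑ (λ v → χ (dot x y xor inner v ys) * (g x * weight g v)) (words n)) elementsL
    ≡⟨ ∑-cong′ elementsL (λ x → ∑-cong′ (words n) (λ v → separate (dot x y) (inner v ys) (g x) (weight g v))) ⟩
  ∑ (λ x → ∑ (λ v → (χ (dot x y) * g x) * (χ (inner v ys) * weight g v)) (words n)) elementsL
    ≡⟨ ∑-cong′ elementsL (λ x → ∑-*ˡ (χ (dot x y) * g x) (λ v → χ (inner v ys) * weight g v) (words n)) ⟩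
  ∑ (λ x → (χ (dot x y) * g x) * ∑ (λ v → χ (inner v ys) * weight g v) (words n)) elementsL
    ≡⟨ ∑-cong′ elementsL (λ x → cong ((χ (dot x y) * g x) *_) (fourier-weight g ys)) ⟩
  ∑ (λ x → (χ (dot x y) * g x) * weight (fourier g) ys) elementsL
    ≡⟨ ∑-*ʳ (λ x → χ (dot x y) * g x) (weight (fourier g) ys) elementsL ⟩
  fourier g y * weight (fourier g) ys ∎
  where
  open ≡-Reasoning
  separate : ∀ a b c d → χ (a xor b) * (c * d) ≡ (χ a * c) * (χ b * d)
  separate a b c d = trans (cong (_* (c * d)) (χ-xor a b)) (regroup (χ a) (χ b) c d)
    where
    regroup : ∀ p q c d → (p * q) * (c * d) ≡ (p * c) * (q * d)
    regroup = solve-∀ ℚ-ring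

letterWeight : ℚ × ℚ × ℚ → L → ℚ
letterWeight (x , y , z) 𝟘 = x
letterWeight (x , y , z) 𝟙 = y
letterWeight (x , y , z) ω = z
letterWeight (x , y , z) ω̄ = z

T : ℚ × ℚ × ℚ → ℚ × ℚ × ℚ
T (x , y , z) = ½ * (x + y + two * z) , ½ * (x + y - two * z) , ½ * (x - y)

T-involutive : ∀ p → T (T p) ≡ p
T-involutive (x , y , z) = cong₂ _,_ (first x y z) (cong₂ _,_ (second x y z) (third x y z))
  where
  first : ∀ x y z → ½ * (½ * (x + y + two * z) + ½ * (x + y - two * z) + two * (½ * (x - y))) ≡ x
  first = solve-∀ ℚ-ring
  second : ∀ x y z → ½ * (½ * (x + y + two * z) + ½ * (x + y - two * z) - two * (½ * (x - y))) ≡ y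
  second = solve-∀ ℚ-ring
  third : ∀ x y z → ½ * (½ * (x + y + two * z) - ½ * (x + y - two * z)) ≡ z
  third = solve-∀ ℚ-ring

-- The Fourier transform maps letter weights to letter weights: ĝ_p = 2 g_(T p).
-- Each clause is one row of the character table of L, written out as fourier computes it.
fourier-letterWeight : ∀ p l → fourier (letterWeight p) l ≡ two * letterWeight (T p) l
fourier-letterWeight (x , y , z) 𝟘 = row x y z
  where
  row : ∀ x y z → 1ℚ * x + (1ℚ * y + (1ℚ * z + (1ℚ * z + 0ℚ))) ≡ two * (½ * (x + y + two * z))
  row = solve-∀ ℚ-ring
fourier-letterWeight (x , y , z) 𝟙 = row x y z
  where
  row : ∀ x y z → 1ℚ * x + (1ℚ * y + (- 1ℚ * z + (- 1ℚ * z + 0ℚ))) ≡ two * (½ * (x + y - two * z))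
  row = solve-∀ ℚ-ring
fourier-letterWeight (x , y , z) ω = row x y z
  where
  row : ∀ x y z → 1ℚ * x + (- 1ℚ * y + (1ℚ * z + (- 1ℚ * z + 0ℚ))) ≡ two * (½ * (x - y))
  row = solve-∀ ℚ-ring
fourier-letterWeight (x , y , z) ω̄ = row x y z
  where
  row : ∀ x y z → 1ℚ * x + (- 1ℚ * y + (- 1ℚ * z + (1ℚ * z + 0ℚ))) ≡ two * (½ * (x - y))
  row = solve-∀ ℚ-ring

weight-cong : ∀ {n} {g h : L → ℚ} → (∀ l → g l ≡ h l) → (v : Vec L n) → weight g v ≡ weight h v
weight-cong g≡h [] = refl
weight-cong g≡h (x ∷ v) = cong₂ _*_ (g≡h x) (weight-cong g≡h v)

weight-scale : ∀ {n} (k : ℚ) (g : L → ℚ) (v : Vec L n) → weight (λ l → k * g l) v ≡ pow k n * weight g v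
weight-scale k g [] = sym (*-identityˡ 1ℚ)
weight-scale {suc n} k g (x ∷ v) = trans (cong (k * g x *_) (weight-scale k g v)) (regroup k (g x) (pow k n) (weight g v))
  where
  regroup : ∀ k a p w → (k * a) * (p * w) ≡ (k * p) * (a * w)
  regroup = solve-∀ ℚ-ring

enumerator : ∀ {n} → List (Vec L n) → ℚ × ℚ × ℚ → ℚ
enumerator C p = ∑ (weight (letterWeight p)) C

module SelfDualCode {n : ℕ} (C : List (Vec L n)) (C-unique : Unique C)
    (closed : ∀ x y → x ∈ C → y ∈ C → addV x y ∈ C)
    (self-dual : ∀ z → (z ∈ C) ⇔ (∀ y → y ∈ C → inner z y ≡ false)) where

  open import Data.List.Membership.DecPropositional (≡-dec {n = n} _≟L_) using (_∈?_)

  size : ℚ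
  size = ∑ (λ _ → 1ℚ) C

  ∑-translate : ∀ {y₀} → y₀ ∈ C → (h : Vec L n → ℚ) → ∑ (λ c → h (addV y₀ c)) C ≡ ∑ h C
  ∑-translate {y₀} y₀∈C h = begin
    ∑ (λ c → h (addV y₀ c)) C   ≡⟨ sym (∑-map h (addV y₀) C) ⟩
    ∑ h (map (addV y₀) C)       ≡⟨ ∑-sameElements h (map⁺ translate-injective C-unique) C-unique (mk⇔ to from) ⟩
    ∑ h C ∎
    where
    open ≡-Reasoning
    translate-injective : ∀ {a b} → addV y₀ a ≡ addV y₀ b → a ≡ b
    translate-injective {a} {b} e =
      trans (sym (addV-self-inverse y₀ a)) (trans (cong (addV y₀) e) (addV-self-inverse y₀ b))
    to : ∀ {z} → z ∈ map (addV y₀) C → z ∈ C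
    to z∈ with ∈-map⁻ (addV y₀) z∈
    ... | c , c∈C , refl = closed y₀ c y₀∈C c∈C
    from : ∀ {z} → z ∈ C → z ∈ map (addV y₀) C
    from {z} z∈C = subst (_∈ map (addV y₀) C) (addV-self-inverse y₀ z) (∈-map⁺ (addV y₀) (closed y₀ z y₀∈C z∈C))

  non-orthogonal-witness : ∀ {v} → ¬ (v ∈ C) → ∃ λ y → y ∈ C × inner v y ≡ true
  non-orthogonal-witness {v} v∉C with all? (λ y → inner v y Bool.≟ false) C
  ... | yes orthogonal = ⊥-elim (v∉C (Equivalence.from (self-dual v) (λ y → All.lookup orthogonal)))
  ... | no ¬orthogonal with find (All.¬All⇒Any¬ (λ y → inner v y Bool.≟ false) C ¬orthogonal)
  ...   | y , y∈C , ≢false = y , y∈C , Bool.¬-not ≢false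

  -- Orthogonality of characters: ∑_{y ∈ C} (-1)^(v,y) = |C| · [v ∈ C].  For v ∉ C pick
  -- y₀ ∈ C with (v, y₀) = 1; translating the sum by y₀ changes its sign, so it vanishes.
  character-sum : ∀ v → ∑ (λ y → χ (inner v y)) C ≡ size * indicator (v ∈? C)
  character-sum v with v ∈? C
  ... | yes v∈C = trans (∑-cong C (λ y y∈C → cong χ (Equivalence.to (self-dual v) v∈C y y∈C)))
                           (sym (*-identityʳ size))
  ... | no v∉C with non-orthogonal-witness v∉C
  ...   | y₀ , y₀∈C , v·y₀≡true = trans (self-negative⇒zero _ sum≡-sum) (sym (*-zeroʳ size))
    where
    open ≡-Reasoning
    sum≡-sum : ∑ (λ y → χ (inner v y)) C ≡ - ∑ (λ y → χ (inner v y)) C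
    sum≡-sum = begin
      ∑ (λ y → χ (inner v y)) C                   ≡⟨ sym (∑-translate y₀∈C (λ y → χ (inner v y))) ⟩
      ∑ (λ c → χ (inner v (addV y₀ c))) C         ≡⟨ ∑-cong′ C flip ⟩      
      ∑ (λ c → - χ (inner v c)) C                 ≡⟨ ∑-neg (λ c → χ (inner v c)) C ⟩
      - ∑ (λ y → χ (inner v y)) C ∎
      where
      flip : ∀ c → χ (inner v (addV y₀ c)) ≡ - χ (inner v c)
      flip c = begin
        χ (inner v (addV y₀ c))           ≡⟨ cong χ (inner-linear v y₀ c) ⟩
        χ (inner v y₀ xor inner v c)      ≡⟨ χ-xor (inner v y₀) (inner v c) ⟩
        χ (inner v y₀) * χ (inner v c)    ≡⟨ cong (λ b → χ b * χ (inner v c)) v·y₀≡true ⟩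
        - 1ℚ * χ (inner v c)              ≡⟨ sym (neg-distribˡ-* 1ℚ (χ (inner v c))) ⟩
        - (1ℚ * χ (inner v c))            ≡⟨ cong -_ (*-identityˡ (χ (inner v c))) ⟩
        - χ (inner v c) ∎

  ∑-words-indicator : (f : Vec L n → ℚ) → ∑ (λ v → indicator (v ∈? C) * f v) (words n) ≡ ∑ f C
  ∑-words-indicator f = trans (∑-filter (_∈? C) f (words n))
    (∑-sameElements f (filter⁺ (_∈? C) (words-unique n)) C-unique
      (mk⇔ (λ v∈ → proj₂ (∈-filter⁻ (_∈? C) {xs = words n} v∈))
           (λ v∈C → ∈-filter⁺ (_∈? C) (words-complete _) v∈C)))

  macWilliams : (g : L → ℚ) → ∑ (weight (fourier g)) C ≡ size * ∑ (weight g) C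
  macWilliams g = begin
    ∑ (weight (fourier g)) C
      ≡⟨ sym (∑-cong′ C (fourier-weight g)) ⟩
    ∑ (λ y → ∑ (λ v → χ (inner v y) * weight g v) (words n)) C
      ≡⟨ ∑-swap (λ y v → χ (inner v y) * weight g v) C (words n) ⟩
    ∑ (λ v → ∑ (λ y → χ (inner v y) * weight g v) C) (words n)
      ≡⟨ ∑-cong′ (words n) (λ v → ∑-*ʳ (λ y → χ (inner v y)) (weight g v) C) ⟩
    ∑ (λ v → ∑ (λ y → χ (inner v y)) C * weight g v) (words n)
      ≡⟨ ∑-cong′ (words n) (λ v → trans (cong (_* weight g v) (character-sum v)) (*-assoc size _ _)) ⟩
    ∑ (λ v → size * (indicator (v ∈? C) * weight g v)) (words n)
      ≡⟨ ∑-*ˡ size (λ v → indicator (v ∈? C) * weight g v) (words n) ⟩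
    size * ∑ (λ v → indicator (v ∈? C) * weight g v) (words n)
      ≡⟨ cong (size *_) (∑-words-indicator (weight g)) ⟩
    size * ∑ (weight g) C ∎
    where open ≡-Reasoning

  W : ℚ × ℚ × ℚ → ℚ
  W = enumerator C

  macWilliams-W : ∀ p → size * W p ≡ pow two n * W (T p)
  macWilliams-W p = begin
    size * W p                                            ≡⟨ sym (macWilliams (letterWeight p)) ⟩
    ∑ (weight (fourier (letterWeight p))) C              ≡⟨ ∑-cong′ C (weight-cong (fourier-letterWeight p)) ⟩
    ∑ (weight (λ l → two * letterWeight (T p) l)) C      ≡⟨ ∑-cong′ C (weight-scale two (letterWeight (T p))) ⟩
    ∑ (λ c → pow two n * weight (letterWeight (T p)) c) C ≡⟨ ∑-*ˡ (pow two n) (weight (letterWeight (T p))) C ⟩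
    pow two n * W (T p) ∎
    where open ≡-Reasoning

  -- W is invariant under T: the MacWilliams identity at p and at T p = T⁻¹ p gives
  -- |C| W(p) = 2ⁿ W(T p) and |C| W(T p) = 2ⁿ W(p), with |C| + 2ⁿ > 0.
  W-invariant : ∀ p → W (T p) ≡ W p
  W-invariant p = sym (swapped-equations⇒equal size (pow two n) (W p) (W (T p)) size+2ⁿ>0
    (macWilliams-W p) (trans (macWilliams-W (T p)) (cong (λ q → pow two n * W q) (T-involutive p))))
    where
    size+2ⁿ>0 : Positive (size + pow two n)
    size+2ⁿ>0 = nonNeg+pos⇒pos size {{∑-ones-nonNegative C}} (pow two n) {{pow-positive _ n}}

Monomial : Set
Monomial = ℚ × ℕ × ℕ × ℕ

_·ₘ_ : Monomial → Monomial → Monomial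
(c , i , j , k) ·ₘ (c′ , i′ , j′ , k′) = c * c′ , i ℕ.+ i′ , j ℕ.+ j′ , k ℕ.+ k′

_*ₚ_ : Poly3 → Poly3 → Poly3
P *ₚ Q = concatMap (λ m → map (m ·ₘ_) Q) P

module Evaluation (x₁ x₂ x₃ : ℚ) where

  ev : Monomial → ℚ
  ev = evalMon x₁ x₂ x₃

  eval : Poly3 → ℚ
  eval P = eval3 P x₁ x₂ x₃

  ev-·ₘ : ∀ m m′ → ev (m ·ₘ m′) ≡ ev m * ev m′
  ev-·ₘ (c , i , j , k) (c′ , i′ , j′ , k′) =
    trans (cong₂ (λ p q → (c * c′) * p * q * pow x₃ (k ℕ.+ k′)) (pow-+ x₁ i i′) (pow-+ x₂ j j′))
      (trans (cong ((c * c′) * (pow x₁ i * pow x₁ i′) * (pow x₂ j * pow x₂ j′) *_) (pow-+ x₃ k k′))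
        (regroup c c′ (pow x₁ i) (pow x₁ i′) (pow x₂ j) (pow x₂ j′) (pow x₃ k) (pow x₃ k′)))
    where
    regroup : ∀ c c′ a a′ b b′ d d′ →
      (c * c′) * (a * a′) * (b * b′) * (d * d′) ≡ (c * a * b * d) * (c′ * a′ * b′ * d′)
    regroup = solve-∀ ℚ-ring

  eval-++ : ∀ P Q → eval (P ++ Q) ≡ eval P + eval Q
  eval-++ = ∑-++ ev

  eval-*ₚ : ∀ P Q → eval (P *ₚ Q) ≡ eval P * eval Q
  eval-*ₚ P Q = begin
    ∑ ev (concatMap (λ m → map (m ·ₘ_) Q) P)   ≡⟨ ∑-concatMap ev (λ m → map (m ·ₘ_) Q) P ⟩
    ∑ (λ m → ∑ ev (map (m ·ₘ_) Q)) P           ≡⟨ ∑-cong′ P (λ m → ∑-map ev (m ·ₘ_) Q) ⟩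
    ∑ (λ m → ∑ (λ m′ → ev (m ·ₘ m′)) Q) P      ≡⟨ ∑-cong′ P (λ m → ∑-cong′ Q (ev-·ₘ m)) ⟩
    ∑ (λ m → ∑ (λ m′ → ev m * ev m′) Q) P      ≡⟨ ∑-cong′ P (λ m → ∑-*ˡ (ev m) ev Q) ⟩
    ∑ (λ m → ev m * eval Q) P                  ≡⟨ ∑-*ʳ ev (eval Q) P ⟩
    eval P * eval Q ∎
    where open ≡-Reasoning

-- The monomial m has weighted degree d − s, that is s + wdeg m ≡ d.  The offset s
-- expresses "degree n − 1" without truncated subtraction, also when n = 0.
record HasDegree (s d : ℕ) (m : Monomial) : Set where
  constructor hasDegree
  field
    shifted-degree : s ℕ.+ wdeg m ≡ d

Homogeneous : ℕ → ℕ → Poly3 → Set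
Homogeneous s d P = All (HasDegree s d) P

wdeg-·ₘ : ∀ m m′ → wdeg (m ·ₘ m′) ≡ wdeg m ℕ.+ wdeg m′
wdeg-·ₘ (c , i , j , k) (c′ , i′ , j′ , k′) = regroup i j k i′ j′ k′
  where
  regroup : ∀ i j k i′ j′ k′ →
    (i ℕ.+ i′) ℕ.+ (j ℕ.+ j′) ℕ.+ 2 ℕ.* (k ℕ.+ k′) ≡ (i ℕ.+ j ℕ.+ 2 ℕ.* k) ℕ.+ (i′ ℕ.+ j′ ℕ.+ 2 ℕ.* k′)
  regroup = ℕ-solve-∀

homogeneous-++ : ∀ {s d P Q} → Homogeneous s d P → Homogeneous s d Q → Homogeneous s d (P ++ Q)
homogeneous-++ = All.++⁺

homogeneous-*ₚ : ∀ {s d t e P Q} → Homogeneous s d P → Homogeneous t e Q →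
  Homogeneous (s ℕ.+ t) (d ℕ.+ e) (P *ₚ Q)
homogeneous-*ₚ {s} {d} {t} {e} {Q = Q} hP hQ =
  All.concat⁺ (All.map⁺ (All.map (λ {m} hm → All.map⁺ (All.map (λ {m′} hm′ → product-degree m m′ hm hm′) hQ)) hP))
  where
  product-degree : ∀ m m′ → HasDegree s d m → HasDegree t e m′ → HasDegree (s ℕ.+ t) (d ℕ.+ e) (m ·ₘ m′)
  product-degree m m′ (hasDegree refl) (hasDegree refl) =
    hasDegree (trans (cong ((s ℕ.+ t) ℕ.+_) (wdeg-·ₘ m m′)) (regroup s t (wdeg m) (wdeg m′)))
    where
    regroup : ∀ s t w w′ → (s ℕ.+ t) ℕ.+ (w ℕ.+ w′) ≡ (s ℕ.+ w) ℕ.+ (t ℕ.+ w′)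
    regroup = ℕ-solve-∀

homogeneous-pred : ∀ {s d P} → Homogeneous (suc s) (suc d) P → Homogeneous s d P
homogeneous-pred = All.map (λ (hasDegree e) → hasDegree (ℕ.suc-injective e))

three four ¼ ¾ : ℚ
three = two + 1ℚ
four = two * two
¼ = ½ * ½
¾ = ½ + ¼

M : Poly3
M = (four , 0 , 0 , 1) ∷ (- three , 2 , 0 , 0) ∷ (- four , 0 , 2 , 0) ∷ (four , 1 , 1 , 0) ∷ []

M-homogeneous : Homogeneous 0 2 M
M-homogeneous = hasDegree refl ∷ hasDegree refl ∷ hasDegree refl ∷ hasDegree refl ∷ []

eval-M : ∀ u v X → eval3 M u v X ≡ four * X - three * (u * u) - four * (v * v) + four * (u * v)
eval-M u v X = unfold u v X
  where
  unfold : ∀ u v X →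
    four * 1ℚ * 1ℚ * (X * 1ℚ) + (- three * (u * (u * 1ℚ)) * 1ℚ * 1ℚ + (- four * 1ℚ * (v * (v * 1ℚ)) * 1ℚ
      + (four * (u * 1ℚ) * (v * 1ℚ) * 1ℚ + 0ℚ)))
    ≡ four * X - three * (u * u) - four * (v * v) + four * (u * v)
  unfold = solve-∀ ℚ-ring

linearPart : ℚ → ℚ → Poly3
linearPart α β = (α , 1 , 0 , 0) ∷ (β , 0 , 1 , 0) ∷ []

constant : ℚ → Poly3
constant γ = (γ , 0 , 0 , 0) ∷ []

constant-homogeneous : ∀ s γ → Homogeneous s s (constant γ)
constant-homogeneous s γ = hasDegree (ℕ.+-identityʳ s) ∷ []

-- Writing the weight of a letter as α u + β v + γ m, the weights below have the
-- coefficients (α, β, γ) of the letter.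
letterCoefficients : L → ℚ × ℚ × ℚ
letterCoefficients 𝟘 = ¼ , ½ , ¼
letterCoefficients 𝟙 = ¾ , - ½ , - ¼
letterCoefficients ω = - ¼ , ½ , - ¼
letterCoefficients ω̄ = - ¼ , ½ , - ¼

-- Multiplying E + m·O by α u + β v + γ m and reducing with m² = M gives the
-- new parts (α X₁ + β X₂) E + γ M O and (α X₁ + β X₂) O + γ E.
partsStep : ℚ × ℚ × ℚ → Poly3 × Poly3 → Poly3 × Poly3
partsStep (α , β , γ) (E , O) =
  (linearPart α β *ₚ E) ++ ((constant γ *ₚ M) *ₚ O) , (linearPart α β *ₚ O) ++ (constant γ *ₚ E)

-- The even and odd parts (E_c, O_c) of a word c: its weight is E_c + m · O_c.
parts : ∀ {n} → Vec L n → Poly3 × Poly3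
parts [] = constant 1ℚ , []
parts (l ∷ c) = partsStep (letterCoefficients l) (parts c)

partsStep-homogeneous : ∀ κ {n} EO → Homogeneous 0 n (proj₁ EO) → Homogeneous 1 n (proj₂ EO) →
  Homogeneous 0 (suc n) (proj₁ (partsStep κ EO)) × Homogeneous 1 (suc n) (proj₂ (partsStep κ EO))
partsStep-homogeneous (α , β , γ) (E , O) hE hO =
  homogeneous-++ (homogeneous-*ₚ linear hE) (homogeneous-pred (homogeneous-*ₚ γM hO)) ,
  homogeneous-++ (homogeneous-*ₚ linear hO) (homogeneous-*ₚ (constant-homogeneous 1 γ) hE)
  where
  linear : Homogeneous 0 1 (linearPart α β)
  linear = hasDegree refl ∷ hasDegree refl ∷ []
  γM : Homogeneous 0 2 (constant γ *ₚ M)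
  γM = homogeneous-*ₚ (constant-homogeneous 0 γ) M-homogeneous

parts-homogeneous : ∀ {n} (c : Vec L n) → Homogeneous 0 n (proj₁ (parts c)) × Homogeneous 1 n (proj₂ (parts c))
parts-homogeneous [] = constant-homogeneous 0 1ℚ , []
parts-homogeneous (l ∷ c) =
  partsStep-homogeneous (letterCoefficients l) (parts c) (proj₁ (parts-homogeneous c)) (proj₂ (parts-homogeneous c))

affineIn : ℚ → ℚ → ℚ → ℚ × ℚ × ℚ → ℚ
affineIn u v m (α , β , γ) = α * u + β * v + γ * m

letterValue : ℚ → ℚ → ℚ → L → ℚ
letterValue u v m l = affineIn u v m (letterCoefficients l)

evenPart : ∀ {n} → List (Vec L n) → Poly3
evenPart C = concatMap (λ c → proj₁ (parts c)) C

oddPart : ∀ {n} → List (Vec L n) → Poly3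
oddPart C = concatMap (λ c → proj₂ (parts c)) C

module Decomposition (u v X m : ℚ) (m²≡M : m * m ≡ eval3 M u v X) where

  open Evaluation u v X

  eval-linearPart : ∀ α β → eval (linearPart α β) ≡ α * u + β * v
  eval-linearPart α β = unfold α β u v
    where
    unfold : ∀ α β u v → α * (u * 1ℚ) * 1ℚ * 1ℚ + (β * 1ℚ * (v * 1ℚ) * 1ℚ + 0ℚ) ≡ α * u + β * v
    unfold = solve-∀ ℚ-ring

  eval-constant : ∀ γ → eval (constant γ) ≡ γ
  eval-constant γ = unfold γ
    where
    unfold : ∀ γ → γ * 1ℚ * 1ℚ * 1ℚ + 0ℚ ≡ γ
    unfold = solve-∀ ℚ-ring

  eval-evenStep : ∀ α β γ E O →
    eval (proj₁ (partsStep (α , β , γ) (E , O))) ≡ (α * u + β * v) * eval E + (γ * eval M) * eval O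
  eval-evenStep α β γ E O = begin
    eval ((linearPart α β *ₚ E) ++ ((constant γ *ₚ M) *ₚ O))
      ≡⟨ eval-++ (linearPart α β *ₚ E) ((constant γ *ₚ M) *ₚ O) ⟩
    eval (linearPart α β *ₚ E) + eval ((constant γ *ₚ M) *ₚ O)
      ≡⟨ cong₂ _+_ (eval-*ₚ (linearPart α β) E)
                   (trans (eval-*ₚ (constant γ *ₚ M) O) (cong (_* eval O) (eval-*ₚ (constant γ) M))) ⟩
    eval (linearPart α β) * eval E + (eval (constant γ) * eval M) * eval O
      ≡⟨ cong₂ (λ ℓ c → ℓ * eval E + (c * eval M) * eval O) (eval-linearPart α β) (eval-constant γ) ⟩
    (α * u + β * v) * eval E + (γ * eval M) * eval O ∎
    where open ≡-Reasoning

  eval-oddStep : ∀ α β γ E O →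
    eval (proj₂ (partsStep (α , β , γ) (E , O))) ≡ (α * u + β * v) * eval O + γ * eval E
  eval-oddStep α β γ E O = begin
    eval ((linearPart α β *ₚ O) ++ (constant γ *ₚ E))
      ≡⟨ eval-++ (linearPart α β *ₚ O) (constant γ *ₚ E) ⟩
    eval (linearPart α β *ₚ O) + eval (constant γ *ₚ E)
      ≡⟨ cong₂ _+_ (eval-*ₚ (linearPart α β) O) (eval-*ₚ (constant γ) E) ⟩
    eval (linearPart α β) * eval O + eval (constant γ) * eval E
      ≡⟨ cong₂ (λ ℓ c → ℓ * eval O + c * eval E) (eval-linearPart α β) (eval-constant γ) ⟩
    (α * u + β * v) * eval O + γ * eval E ∎
    where open ≡-Reasoning

  partsStep-eval : ∀ κ EO →
    affineIn u v m κ * (eval (proj₁ EO) + m * eval (proj₂ EO)) ≡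
      eval (proj₁ (partsStep κ EO)) + m * eval (proj₂ (partsStep κ EO))
  partsStep-eval (α , β , γ) (E , O) = sym (begin
    eval (proj₁ (partsStep (α , β , γ) (E , O))) + m * eval (proj₂ (partsStep (α , β , γ) (E , O)))
      ≡⟨ cong₂ (λ p q → p + m * q) (eval-evenStep α β γ E O) (eval-oddStep α β γ E O) ⟩
    (ℓ * eval E + (γ * eval M) * eval O) + m * (ℓ * eval O + γ * eval E)
      ≡⟨ cong (λ q → (ℓ * eval E + (γ * q) * eval O) + m * (ℓ * eval O + γ * eval E)) (sym m²≡M) ⟩
    (ℓ * eval E + (γ * (m * m)) * eval O) + m * (ℓ * eval O + γ * eval E)
      ≡⟨ expand ℓ γ m (eval E) (eval O) ⟩
    (ℓ + γ * m) * (eval E + m * eval O) ∎)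
    where
    open ≡-Reasoning
    ℓ : ℚ
    ℓ = α * u + β * v
    expand : ∀ l γ m e o → (l * e + (γ * (m * m)) * o) + m * (l * o + γ * e) ≡ (l + γ * m) * (e + m * o)
    expand = solve-∀ ℚ-ring

  parts-eval : ∀ {n} (c : Vec L n) →
    weight (letterValue u v m) c ≡ eval (proj₁ (parts c)) + m * eval (proj₂ (parts c))
  parts-eval [] = unfold m
    where
    unfold : ∀ m → 1ℚ ≡ (1ℚ * 1ℚ * 1ℚ * 1ℚ + 0ℚ) + m * 0ℚ
    unfold = solve-∀ ℚ-ring
  parts-eval (l ∷ c) = trans (cong (letterValue u v m l *_) (parts-eval c)) (partsStep-eval (letterCoefficients l) (parts c))

  enumerator-split : ∀ {n} (C : List (Vec L n)) →
    ∑ (weight (letterValue u v m)) C ≡ eval (evenPart C) + m * eval (oddPart C)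
  enumerator-split C = begin
    ∑ (weight (letterValue u v m)) C
      ≡⟨ ∑-cong′ C parts-eval ⟩
    ∑ (λ c → eval (proj₁ (parts c)) + m * eval (proj₂ (parts c))) C
      ≡⟨ ∑-+ _ _ C ⟩
    ∑ (λ c → eval (proj₁ (parts c))) C + ∑ (λ c → m * eval (proj₂ (parts c))) C
      ≡⟨ cong₂ _+_ (sym (∑-concatMap ev (λ c → proj₁ (parts c)) C))
                   (trans (∑-*ˡ m _ C) (cong (m *_) (sym (∑-concatMap ev (λ c → proj₂ (parts c)) C)))) ⟩
    eval (evenPart C) + m * eval (oddPart C) ∎
    where open ≡-Reasoning

evenPart-homogeneous : ∀ {n} (C : List (Vec L n)) → Homogeneous 0 n (evenPart C)
evenPart-homogeneous C = All.concat⁺ (All.map⁺ (All.tabulate {xs = C} (λ {c} _ → proj₁ (parts-homogeneous c))))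

cwt : ∀ {n} → Vec L n → ℕ
cwt [] = 0
cwt (x ∷ c) = (2 ℕ.∸ nrm x) ℕ.+ cwt c

cwt+ewt : ∀ {n} (c : Vec L n) → cwt c ℕ.+ ewt c ≡ 2 ℕ.* n
cwt+ewt [] = refl
cwt+ewt {suc n} (x ∷ c) = begin
  ((2 ℕ.∸ nrm x) ℕ.+ cwt c) ℕ.+ (nrm x ℕ.+ ewt c)   ≡⟨ regroup (2 ℕ.∸ nrm x) (cwt c) (nrm x) (ewt c) ⟩
  ((2 ℕ.∸ nrm x) ℕ.+ nrm x) ℕ.+ (cwt c ℕ.+ ewt c)   ≡⟨ cong₂ ℕ._+_ (letter x) (cwt+ewt c) ⟩
  2 ℕ.+ 2 ℕ.* n                                      ≡⟨ sym (ℕ.*-suc 2 n) ⟩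
  2 ℕ.* suc n ∎
  where
  open ≡-Reasoning
  regroup : ∀ k w j e → (k ℕ.+ w) ℕ.+ (j ℕ.+ e) ≡ (k ℕ.+ j) ℕ.+ (w ℕ.+ e)
  regroup = ℕ-solve-∀
  letter : ∀ x → (2 ℕ.∸ nrm x) ℕ.+ nrm x ≡ 2
  letter 𝟘 = refl
  letter 𝟙 = refl
  letter ω = refl
  letter ω̄ = refl

EW-letter : ∀ (a b : ℚ) l → pow a (2 ℕ.∸ nrm l) * pow b (nrm l) ≡ letterWeight (a * a , a * b , b * b) l
EW-letter a b 𝟘 = unfold a
  where
  unfold : ∀ a → a * (a * 1ℚ) * 1ℚ ≡ a * a
  unfold = solve-∀ ℚ-ring
EW-letter a b 𝟙 = unfold a b
  where
  unfold : ∀ a b → a * 1ℚ * (b * 1ℚ) ≡ a * b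
  unfold = solve-∀ ℚ-ring
EW-letter a b ω = unfold b
  where
  unfold : ∀ b → 1ℚ * (b * (b * 1ℚ)) ≡ b * b
  unfold = solve-∀ ℚ-ring
EW-letter a b ω̄ = EW-letter a b ω

EW-product : ∀ {n} (a b : ℚ) (c : Vec L n) →
  pow a (cwt c) * pow b (ewt c) ≡ weight (letterWeight (a * a , a * b , b * b)) c
EW-product a b [] = *-identityˡ 1ℚ
EW-product a b (l ∷ c) = begin
  pow a ((2 ℕ.∸ nrm l) ℕ.+ cwt c) * pow b (nrm l ℕ.+ ewt c)
    ≡⟨ cong₂ _*_ (pow-+ a (2 ℕ.∸ nrm l) (cwt c)) (pow-+ b (nrm l) (ewt c)) ⟩
  (pow a (2 ℕ.∸ nrm l) * pow a (cwt c)) * (pow b (nrm l) * pow b (ewt c))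
    ≡⟨ regroup (pow a (2 ℕ.∸ nrm l)) (pow a (cwt c)) (pow b (nrm l)) (pow b (ewt c)) ⟩
  (pow a (2 ℕ.∸ nrm l) * pow b (nrm l)) * (pow a (cwt c) * pow b (ewt c))
    ≡⟨ cong₂ _*_ (EW-letter a b l) (EW-product a b c) ⟩
  letterWeight (a * a , a * b , b * b) l * weight (letterWeight (a * a , a * b , b * b)) c ∎
  where
  open ≡-Reasoning
  regroup : ∀ p q r s → (p * q) * (r * s) ≡ (p * r) * (q * s)
  regroup = solve-∀ ℚ-ring

EW-term : ∀ {n} (a b : ℚ) (c : Vec L n) →
  pow a (2 ℕ.* n ℕ.∸ ewt c) * pow b (ewt c) ≡ weight (letterWeight (a * a , a * b , b * b)) c
EW-term {n} a b c = trans (cong (λ k → pow a k * pow b (ewt c)) exponent) (EW-product a b c)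
  where
  exponent : 2 ℕ.* n ℕ.∸ ewt c ≡ cwt c
  exponent = trans (cong (ℕ._∸ ewt c) (sym (cwt+ewt c))) (ℕ.m+n∸n≡m (cwt c) (ewt c))

EW-as-enumerator : ∀ {n} (C : List (Vec L n)) (a b : ℚ) → EW C a b ≡ enumerator C (a * a , a * b , b * b)
EW-as-enumerator C a b = ∑-cong′ C (EW-term a b)

-- Here m² = M(u, v, X), and T amounts to m ↦ −m: the letter weights
-- at p are α u + β v + γ m and those at T p are α u + β v − γ m.
module Point (a b : ℚ) where

  p : ℚ × ℚ × ℚ
  p = a * a , a * b , b * b

  u v X m : ℚ
  u = a * a + a * b
  v = a * a + b * b
  X = pow a 4 + pow a 2 * pow b 2 + two * pow b 4
  m = a * a - a * b - two * (b * b)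

  m²≡M : m * m ≡ eval3 M u v X
  m²≡M = trans (square a b) (sym (eval-M u v X))
    where
    square : ∀ a b →
      (a * a - a * b - two * (b * b)) * (a * a - a * b - two * (b * b)) ≡
      four * (a * (a * (a * (a * 1ℚ))) + a * (a * 1ℚ) * (b * (b * 1ℚ)) + two * (b * (b * (b * (b * 1ℚ)))))
        - three * ((a * a + a * b) * (a * a + a * b)) - four * ((a * a + b * b) * (a * a + b * b))
        + four * ((a * a + a * b) * (a * a + b * b))
    square = solve-∀ ℚ-ring

  -m²≡M : - m * - m ≡ eval3 M u v X
  -m²≡M = trans (neg-square m) m²≡M
    where
    neg-square : ∀ m → - m * - m ≡ m * m
    neg-square = solve-∀ ℚ-ring

  letters-at-p : ∀ l → letterWeight p l ≡ letterValue u v m l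
  letters-at-p 𝟘 = zero-letter a b
    where
    zero-letter : ∀ a b → a * a ≡ ¼ * (a * a + a * b) + ½ * (a * a + b * b) + ¼ * (a * a - a * b - two * (b * b))
    zero-letter = solve-∀ ℚ-ring
  letters-at-p 𝟙 = one-letter a b
    where
    one-letter : ∀ a b → a * b ≡ ¾ * (a * a + a * b) + - ½ * (a * a + b * b) + - ¼ * (a * a - a * b - two * (b * b))
    one-letter = solve-∀ ℚ-ring
  letters-at-p ω = omega-letter a b
    where
    omega-letter : ∀ a b → b * b ≡ - ¼ * (a * a + a * b) + ½ * (a * a + b * b) + - ¼ * (a * a - a * b - two * (b * b))
    omega-letter = solve-∀ ℚ-ring
  letters-at-p ω̄ = letters-at-p ω

  letters-at-Tp : ∀ l → letterWeight (T p) l ≡ letterValue u v (- m) l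
  letters-at-Tp 𝟘 = zero-letter a b
    where
    zero-letter : ∀ a b → ½ * (a * a + a * b + two * (b * b)) ≡
      ¼ * (a * a + a * b) + ½ * (a * a + b * b) + ¼ * - (a * a - a * b - two * (b * b))
    zero-letter = solve-∀ ℚ-ring
  letters-at-Tp 𝟙 = one-letter a b
    where
    one-letter : ∀ a b → ½ * (a * a + a * b - two * (b * b)) ≡
      ¾ * (a * a + a * b) + - ½ * (a * a + b * b) + - ¼ * - (a * a - a * b - two * (b * b))
    one-letter = solve-∀ ℚ-ring
  letters-at-Tp ω = omega-letter a b
    where
    omega-letter : ∀ a b → ½ * (a * a - a * b) ≡
      - ¼ * (a * a + a * b) + ½ * (a * a + b * b) + - ¼ * - (a * a - a * b - two * (b * b))
    omega-letter = solve-∀ ℚ-ring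
  letters-at-Tp ω̄ = letters-at-Tp ω

  -- A T-invariant enumerator equals its even part at (u, v, X): averaging the splittings
  -- W(p) = E + m O and W(T p) = E − m O cancels the odd part.
  T-invariant⇒even : ∀ {n} (C : List (Vec L n)) →
    enumerator C (T p) ≡ enumerator C p → enumerator C p ≡ eval3 (evenPart C) u v X
  T-invariant⇒even C invariant = begin
    W p                                ≡⟨ halve (W p) ⟩
    ½ * (W p + W p)                    ≡⟨ cong (λ q → ½ * (W p + q)) (sym invariant) ⟩
    ½ * (W p + W (T p))                ≡⟨ cong₂ (λ q r → ½ * (q + r)) split₊ split₋ ⟩
    ½ * ((e + m * o) + (e + - m * o))  ≡⟨ cancel e m o ⟩
    e ∎
    where
    open ≡-Reasoning
    W : ℚ × ℚ × ℚ → ℚ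
    W = enumerator C
    e o : ℚ
    e = eval3 (evenPart C) u v X
    o = eval3 (oddPart C) u v X
    halve : ∀ w → w ≡ ½ * (w + w)
    halve = solve-∀ ℚ-ring
    cancel : ∀ e m o → ½ * ((e + m * o) + (e + - m * o)) ≡ e
    cancel = solve-∀ ℚ-ring
    split₊ : W p ≡ e + m * o
    split₊ = trans (∑-cong′ C (weight-cong letters-at-p)) (Decomposition.enumerator-split u v X m m²≡M C)
    split₋ : W (T p) ≡ e + - m * o
    split₋ = trans (∑-cong′ C (weight-cong letters-at-Tp)) (Decomposition.enumerator-split u v X (- m) -m²≡M C)

-- F = ∑_{c ∈ C} E_c is homogeneous of degree n, and EW_C(a, b) = W_C(p) = F(u, v, X) because
-- W_C is T-invariant.
corollary4p6 : (n : ℕ) (C : List (Vec L n)) →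
  Unique C →
  zeroV n ∈ C →
  (∀ x y → x ∈ C → y ∈ C → addV x y ∈ C) →
  (∀ z → (z ∈ C) ⇔ (∀ y → y ∈ C → inner z y ≡ false)) →
  Σ Poly3 (λ F →
    All (λ m → wdeg m ≡ n) F
    × (∀ (a b : ℚ) →
        EW C a b ≡ eval3 F (a * a + a * b) (a * a + b * b)
                      (pow a 4 + pow a 2 * pow b 2 + two * pow b 4)))
corollary4p6 n C C-unique _ closed self-dual =
  evenPart C ,
  All.map HasDegree.shifted-degree (evenPart-homogeneous C) ,
  λ a b → begin
    EW C a b                           ≡⟨ EW-as-enumerator C a b ⟩
    enumerator C (Point.p a b)         ≡⟨ Point.T-invariant⇒even a b C (W-invariant (Point.p a b)) ⟩
    eval3 (evenPart C) (Point.u a b) (Point.v a b) (Point.X a b) ∎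
  where
  open ≡-Reasoning
  open SelfDualCode C C-unique closed self-dual
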